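{- Let $d\ge2$ and let $S=\{\mathbf{r}(m)-\mathbf{r}(n): m,n\in\mathbb{N},\ m\ge n\}$. Then the set $\{\mathbf{x}\in S: x_d<2^{d-1}(2^d-1)\}$ of rows of the shortcut matrix has exactly $3^{d-1}$ elements.
   Context: $\mathbb{N}=\{1,2,\ldots\}$. For $n\in\mathbb{N}$ and $i\in\{1,\ldots,d\}$, $r_i(n)=\left\lfloor \frac{(2^d-1)n}{2^{d-i}}\right\rfloor-2^{i-1}+1$ and $\mathbf{r}(n)=(r_1(n),\ldots,r_d(n))$. Since $\mathbf{r}(n+2^{d-1})=\mathbf{r}(n)+\mathbf{v}$ with $\mathbf{v}=(2^d-1)(1,2,4,\ldots,2^{d-1})$, the set $S$ (the nonnegative shortcut vectors, including $\mathbf{0}$) is a union of families $\{\mathbf{c}+t\mathbf{v}:t\in\mathbb{N}_0\}$; the shortcut matrix is the matrix whose rows are the representatives $\mathbf{c}\in S$ with last coordinate $c_d<2^{d-1}(2^d-1)$ (for $d=3$ these are the $9$ rows $(0,0,0),(1,3,7),(2,3,7),(2,4,7),(3,7,14),(4,7,14),(5,10,21),(5,11,21),(6,11,21)$). -}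

module Defs where

open import Data.Nat as ℕ using (ℕ; zero; suc; _^_; _∸_)
open import Data.Nat.DivMod using (_/_)
open import Data.Nat.Properties using (m^n≢0)
open import Data.Integer as ℤ using (ℤ; +_)
open import Data.Fin using (Fin; toℕ)
open import Data.Vec using (Vec; []; _∷_; tabulate; zipWith)
open import Data.Product using (∃₂; _×_)
open import Relation.Binary.PropositionalEquality using (_≡_)

_/2^_ : ℕ → ℕ → ℕ
a /2^ k = _/_ a (2 ^ k) {{m^n≢0 2 k}}

-- r_i(n) = ⌊(2^d - 1) n / 2^(d-i)⌋ - 2^(i-1) + 1, where i = toℕ j + 1 for j : Fin d
rᵢ : (d : ℕ) → Fin d → ℕ → ℤ
rᵢ d j n = ((+ (((2 ^ d ∸ 1) ℕ.* n) /2^ (d ∸ suc (toℕ j)))) ℤ.- (+ (2 ^ toℕ j))) ℤ.+ (+ 1)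

r : (d : ℕ) → ℕ → Vec ℤ d
r d n = tabulate (λ j → rᵢ d j n)

-- S = { r(m) - r(n) : m, n ∈ ℕ = {1,2,…}, m ≥ n }
InS : (d : ℕ) → Vec ℤ d → Set
InS d x = ∃₂ λ m n → 1 ℕ.≤ n × n ℕ.≤ m × x ≡ zipWith ℤ._-_ (r d m) (r d n)

-- last coordinate x_d (only used with d ≥ 2; value 0 for the empty vector is irrelevant)
lastCoord : ∀ {d} → Vec ℤ d → ℤ
lastCoord [] = + 0
lastCoord (x ∷ []) = x
lastCoord (x ∷ y ∷ xs) = lastCoord (y ∷ xs)

-- Put A = 2^d − 1 and m = d − 1. The difference r(n + k) − r(n) is the vector of jumps
-- ⌊(An + Ak)/2^e⌋ − ⌊An/2^e⌋, e = m, …, 0, whose last entry is Ak; so the rows are these vectors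
-- with k < 2^m. A jump vector depends on its first argument only modulo 2^m, and A ≡ −1 (mod 2^m)
-- makes every residue of the form An with n ≥ 1; hence the rows ending in Ak are all jump vectors
-- ending in Ak. Halving both arguments shows that the number c_m(b) of jump vectors ending in b
-- is 2^m-periodic in b with c_{m+1}(2u) = c_m(u) and c_{m+1}(2u+1) = c_m(u) + c_m(u+1), so
-- Σ_{b<2^m} c_m(b) = 3^m; multiplication by A merely permutes the residues modulo 2^m.

module Submission where

open import Defs
open import Data.Nat as ℕ using (ℕ; zero; suc; _+_; _*_; _^_; _∸_; _≤_; _<_; z≤n; s≤s)
open import Data.Nat.Properties
open import Algebra.Properties.CommutativeSemigroup +-commutativeSemigroup using (xy∙z≈xz∙y)
open import Data.Nat.DivMod
open import Data.Nat.Divisibility using (divides-refl)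
open import Data.Nat.Solver using (module +-*-Solver)
open import Data.Integer as ℤ using (ℤ; +_)
import Data.Integer.Properties as ℤ
import Data.Integer.Solver as ℤ-Solver
open import Data.Fin as Fin using (Fin; toℕ)
open import Data.Vec as V using (Vec; []; _∷_; _∷ʳ_; tabulate; zipWith)
open import Data.Vec.Properties using (tabulate-cong; tabulate-∘; last-∷ʳ; ∷ʳ-injectiveˡ; ∷-injective)
open import Data.List as L using (List; _++_; length)
open import Data.List.Properties using (length-map; length-++)
open import Data.List.Membership.Propositional using (_∈_)
open import Data.List.Membership.Propositional.Properties using (∈-map⁺; ∈-map⁻; ∈-++⁺ˡ; ∈-++⁺ʳ; ∈-++⁻)
open import Data.List.Relation.Unary.Any using (here)
open import Data.List.Relation.Unary.Unique.Propositional using (Unique)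
open import Data.List.Relation.Unary.Unique.Propositional.Properties using (map⁺; ++⁺)
open import Data.List.Relation.Unary.AllPairs using ([]; _∷_)
open import Data.List.Relation.Unary.All using ([])
open import Data.Product using (Σ; _×_; _,_; ∃; ∃₂; proj₁; proj₂)
open import Data.Sum using (inj₁; inj₂)
open import Function.Base using (_∘_)
open import Function.Bundles using (_⇔_; mk⇔; Equivalence)
open import Relation.Binary.PropositionalEquality

half-+ : ∀ a b → (a + b) / 2 ≡ a / 2 + (a % 2 + b) / 2
half-+ a b = begin
  (a + b) / 2                        ≡⟨ cong (λ x → (x + b) / 2) (m≡m%n+[m/n]*n a 2) ⟩
  (a % 2 + a / 2 * 2 + b) / 2        ≡⟨ cong (_/ 2) (xy∙z≈xz∙y (a % 2) (a / 2 * 2) b) ⟩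
  (a % 2 + b + a / 2 * 2) / 2        ≡⟨ +-distrib-/-∣ʳ (a % 2 + b) (divides-refl (a / 2)) ⟩
  (a % 2 + b) / 2 + a / 2 * 2 / 2    ≡⟨ cong (λ x → (a % 2 + b) / 2 + x) (m*n/n≡m (a / 2) 2) ⟩
  (a % 2 + b) / 2 + a / 2            ≡⟨ +-comm ((a % 2 + b) / 2) (a / 2) ⟩
  a / 2 + (a % 2 + b) / 2            ∎
  where open ≡-Reasoning

[i+a*2]/2≡a : ∀ {i} a → i < 2 → (i + a * 2) / 2 ≡ a
[i+a*2]/2≡a {i} a i<2 = begin
  (i + a * 2) / 2      ≡⟨ +-distrib-/-∣ʳ i (divides-refl a) ⟩
  i / 2 + a * 2 / 2    ≡⟨ cong₂ _+_ (m<n⇒m/n≡0 i<2) (m*n/n≡m a 2) ⟩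
  a                    ∎
  where open ≡-Reasoning

[i+a*2]%2≡i : ∀ {i} a → i < 2 → (i + a * 2) % 2 ≡ i
[i+a*2]%2≡i {i} a i<2 = trans ([m+kn]%n≡m%n i a 2) (m<n⇒m%n≡m i<2)

[k*2^e+x]/2^e≡k+x/2^e : ∀ k e x → (k * 2 ^ e + x) /2^ e ≡ k + x /2^ e
[k*2^e+x]/2^e≡k+x/2^e k e x = begin
  (k * 2 ^ e + x) /2^ e             ≡⟨ +-distrib-/-∣ˡ x ⦃ m^n≢0 2 e ⦄ (divides-refl k) ⟩
  (k * 2 ^ e) /2^ e + x /2^ e       ≡⟨ cong (_+ x /2^ e) (m*n/n≡m k (2 ^ e) ⦃ m^n≢0 2 e ⦄) ⟩
  k + x /2^ e                       ∎
  where open ≡-Reasoning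

/2^-suc : ∀ x e → x /2^ suc e ≡ (x / 2) /2^ e
/2^-suc x e = sym (m/n/o≡m/[n*o] x 2 (2 ^ e) ⦃ _ ⦄ ⦃ m^n≢0 2 e ⦄ ⦃ m^n≢0 2 (suc e) ⦄)

carry-bound : ∀ b c → c < 2 → (b % 2 + c) / 2 < suc (b % 2)
carry-bound b c c<2 with b % 2 | m%n<n b 2 | c<2
... | 0 | _ | s≤s z≤n       = s≤s z≤n
... | 0 | _ | s≤s (s≤s z≤n) = s≤s z≤n
... | 1 | _ | s≤s z≤n       = s≤s z≤n
... | 1 | _ | s≤s (s≤s z≤n) = s≤s (s≤s z≤n)
... | suc (suc _) | s≤s (s≤s ()) | _

carry-exact : ∀ b i → i < suc (b % 2) → (b % 2 + i) / 2 ≡ i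
carry-exact b i i≤b%2 with b % 2 | m%n<n b 2 | i≤b%2
... | 0 | _ | s≤s z≤n       = refl
... | 1 | _ | s≤s z≤n       = refl
... | 1 | _ | s≤s (s≤s z≤n) = refl
... | suc (suc _) | s≤s (s≤s ()) | _

half-carry : ∀ b c → (c + b) / 2 ≡ b / 2 + (b % 2 + c) / 2
half-carry b c = trans (cong (_/ 2) (+-comm c b)) (half-+ b c)

sumUpTo : (ℕ → ℕ) → ℕ → ℕ
sumUpTo f zero    = 0
sumUpTo f (suc n) = sumUpTo f n + f n

sumUpTo-cong : ∀ {f g} n → (∀ i → i < n → f i ≡ g i) → sumUpTo f n ≡ sumUpTo g n
sumUpTo-cong zero    f≗g = refl
sumUpTo-cong (suc n) f≗g = cong₂ _+_ (sumUpTo-cong n (λ i i<n → f≗g i (m<n⇒m<1+n i<n))) (f≗g n ≤-refl)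

sumUpTo-suc : ∀ f n → sumUpTo f (suc n) ≡ f 0 + sumUpTo (f ∘ suc) n
sumUpTo-suc f zero    = sym (+-identityʳ (f 0))
sumUpTo-suc f (suc n) = trans (cong (_+ f (suc n)) (sumUpTo-suc f n)) (+-assoc (f 0) _ _)

sumUpTo-rotate : ∀ f n → f n ≡ f 0 → sumUpTo f n ≡ sumUpTo (f ∘ suc) n
sumUpTo-rotate f n fn≡f0 = +-cancelʳ-≡ (f n) _ _ (begin
  sumUpTo f n + f n            ≡⟨ sumUpTo-suc f n ⟩
  f 0 + sumUpTo (f ∘ suc) n    ≡⟨ cong (_+ sumUpTo (f ∘ suc) n) (sym fn≡f0) ⟩
  f n + sumUpTo (f ∘ suc) n    ≡⟨ +-comm (f n) _ ⟩
  sumUpTo (f ∘ suc) n + f n    ∎)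
  where open ≡-Reasoning

sumUpTo-reverse : ∀ f n → sumUpTo (λ k → f (n ∸ suc k)) n ≡ sumUpTo f n
sumUpTo-reverse f zero    = refl
sumUpTo-reverse f (suc n) = begin
  sumUpTo (λ k → f (suc n ∸ suc k)) (suc n)   ≡⟨ sumUpTo-suc (λ k → f (suc n ∸ suc k)) n ⟩
  f n + sumUpTo (λ k → f (n ∸ suc k)) n       ≡⟨ cong (λ x → f n + x) (sumUpTo-reverse f n) ⟩
  f n + sumUpTo f n                           ≡⟨ +-comm (f n) _ ⟩
  sumUpTo f n + f n                           ∎
  where open ≡-Reasoning

sumUpTo-pairs : ∀ {f g} → (∀ u → f (u * 2) ≡ g u) → (∀ u → f (1 + u * 2) ≡ g u + g (suc u)) →
  ∀ n → sumUpTo f (n * 2) + g 0 ≡ 3 * sumUpTo g n + g n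
sumUpTo-pairs f-even f-odd zero    = refl
sumUpTo-pairs {f} {g} f-even f-odd (suc n) = begin
  sumUpTo f (n * 2) + f (n * 2) + f (1 + n * 2) + g 0
    ≡⟨ cong₂ (λ x y → sumUpTo f (n * 2) + x + y + g 0) (f-even n) (f-odd n) ⟩
  sumUpTo f (n * 2) + g n + (g n + g (suc n)) + g 0
    ≡⟨ solve 4 (λ s x y z → s :+ x :+ (x :+ y) :+ z := (s :+ z) :+ (con 2 :* x :+ y)) refl
         (sumUpTo f (n * 2)) (g n) (g (suc n)) (g 0) ⟩
  (sumUpTo f (n * 2) + g 0) + (2 * g n + g (suc n))
    ≡⟨ cong (_+ (2 * g n + g (suc n))) (sumUpTo-pairs f-even f-odd n) ⟩
  (3 * sumUpTo g n + g n) + (2 * g n + g (suc n))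
    ≡⟨ solve 3 (λ s x y → (con 3 :* s :+ x) :+ (con 2 :* x :+ y) := con 3 :* (s :+ x) :+ y) refl
         (sumUpTo g n) (g n) (g (suc n)) ⟩
  3 * sumUpTo g (suc n) + g (suc n)
    ∎
  where
  open ≡-Reasoning
  open +-*-Solver

concatUpTo : {A : Set} → (ℕ → List A) → ℕ → List A
concatUpTo f zero    = L.[]
concatUpTo f (suc n) = concatUpTo f n ++ f n

module _ {A : Set} (f : ℕ → List A) where

  length-concatUpTo : ∀ n → length (concatUpTo f n) ≡ sumUpTo (length ∘ f) n
  length-concatUpTo zero    = refl
  length-concatUpTo (suc n) = trans (length-++ (concatUpTo f n)) (cong (_+ length (f n)) (length-concatUpTo n))

  ∈-concatUpTo⁺ : ∀ {n i y} → i < n → y ∈ f i → y ∈ concatUpTo f n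
  ∈-concatUpTo⁺ {suc n} i<1+n y∈fi with m<1+n⇒m<n∨m≡n i<1+n
  ... | inj₁ i<n  = ∈-++⁺ˡ (∈-concatUpTo⁺ i<n y∈fi)
  ... | inj₂ refl = ∈-++⁺ʳ (concatUpTo f n) y∈fi

  ∈-concatUpTo⁻ : ∀ n {y} → y ∈ concatUpTo f n → ∃ λ i → i < n × y ∈ f i
  ∈-concatUpTo⁻ (suc n) y∈ with ∈-++⁻ (concatUpTo f n) y∈
  ... | inj₁ y∈f<n = let i , i<n , y∈fi = ∈-concatUpTo⁻ n y∈f<n in i , m<n⇒m<1+n i<n , y∈fi
  ... | inj₂ y∈fn  = n , ≤-refl , y∈fn

  concatUpTo-unique : ∀ n → (∀ i → Unique (f i)) →
    (∀ {i j y} → y ∈ f i → y ∈ f j → i ≡ j) → Unique (concatUpTo f n)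
  concatUpTo-unique zero    _ _ = []
  concatUpTo-unique (suc n) f-unique f-disjoint =
    ++⁺ (concatUpTo-unique n f-unique f-disjoint) (f-unique n) λ (y∈f<n , y∈fn) →
      let i , i<n , y∈fi = ∈-concatUpTo⁻ n y∈f<n in <⇒≢ i<n (f-disjoint y∈fi y∈fn)

zipWith-tabulate : ∀ {A B C : Set} {d} (_⊕_ : A → B → C) (f : Fin d → A) (g : Fin d → B) →
  zipWith _⊕_ (tabulate f) (tabulate g) ≡ tabulate (λ j → f j ⊕ g j)
zipWith-tabulate {d = zero}  _⊕_ f g = refl
zipWith-tabulate {d = suc d} _⊕_ f g = cong (f Fin.zero ⊕ g Fin.zero ∷_) (zipWith-tabulate _⊕_ (f ∘ Fin.suc) (g ∘ Fin.suc))

-- Jump vectors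

jump : ℕ → ℕ → ℕ → ℕ
jump e a b = (a + b) /2^ e ∸ a /2^ e

jump-zero : ∀ a b → jump 0 a b ≡ b
jump-zero a b = trans (cong₂ _∸_ (n/1≡n (a + b)) (n/1≡n a)) (m+n∸m≡n a b)

jump-suc : ∀ e a b → jump (suc e) a b ≡ jump e (a / 2) ((a % 2 + b) / 2)
jump-suc e a b = cong₂ _∸_
  (trans (/2^-suc (a + b) e) (cong (_/2^ e) (half-+ a b)))
  (/2^-suc a e)

jump-periodic : ∀ {e m} → e ≤ m → ∀ t a b → jump e (t * 2 ^ m + a) b ≡ jump e a b
jump-periodic {e} {m} e≤m t a b = begin
  (t * 2 ^ m + a + b) /2^ e ∸ (t * 2 ^ m + a) /2^ e
    ≡⟨ cong (λ x → (x + a + b) /2^ e ∸ (x + a) /2^ e) t2^m≡k2^e ⟩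
  (k * 2 ^ e + a + b) /2^ e ∸ (k * 2 ^ e + a) /2^ e
    ≡⟨ cong (λ x → x /2^ e ∸ (k * 2 ^ e + a) /2^ e) (+-assoc (k * 2 ^ e) a b) ⟩
  (k * 2 ^ e + (a + b)) /2^ e ∸ (k * 2 ^ e + a) /2^ e
    ≡⟨ cong₂ _∸_ ([k*2^e+x]/2^e≡k+x/2^e k e (a + b)) ([k*2^e+x]/2^e≡k+x/2^e k e a) ⟩
  (k + (a + b) /2^ e) ∸ (k + a /2^ e)
    ≡⟨ [m+n]∸[m+o]≡n∸o k _ _ ⟩
  (a + b) /2^ e ∸ a /2^ e
    ∎
  where
  open ≡-Reasoning
  k = t * 2 ^ (m ∸ e)
  t2^m≡k2^e : t * 2 ^ m ≡ k * 2 ^ e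
  t2^m≡k2^e = begin
    t * 2 ^ m                  ≡⟨ cong (λ x → t * 2 ^ x) (sym (m∸n+n≡m e≤m)) ⟩
    t * 2 ^ (m ∸ e + e)        ≡⟨ cong (t *_) (^-distribˡ-+-* 2 (m ∸ e) e) ⟩
    t * (2 ^ (m ∸ e) * 2 ^ e)  ≡⟨ sym (*-assoc t _ _) ⟩
    k * 2 ^ e                  ∎

jumps : (d : ℕ) → ℕ → ℕ → Vec ℕ d
jumps d a b = tabulate (λ j → jump (d ∸ suc (toℕ j)) a b)

jumps-∷ʳ : ∀ d a b → jumps (suc d) a b ≡ jumps d (a / 2) ((a % 2 + b) / 2) ∷ʳ b
jumps-∷ʳ zero    a b = cong (_∷ []) (jump-zero a b)
jumps-∷ʳ (suc d) a b = cong₂ _∷_ (jump-suc d a b) (jumps-∷ʳ d a b)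

last-jumps : ∀ d a b → V.last (jumps (suc d) a b) ≡ b
last-jumps zero    a b = jump-zero a b
last-jumps (suc d) a b = trans (cong V.last (jumps-∷ʳ (suc d) a b)) (last-∷ʳ b (jumps (suc d) (a / 2) ((a % 2 + b) / 2)))

jumps-periodic : ∀ m t a b → jumps (suc m) (t * 2 ^ m + a) b ≡ jumps (suc m) a b
jumps-periodic m t a b = tabulate-cong (λ j → jump-periodic (m∸n≤m m (toℕ j)) t a b)

jumps-halves : ∀ m {i} a b → i < 2 →
  jumps (suc (suc m)) (i + a * 2) b ≡ jumps (suc m) a ((i + b) / 2) ∷ʳ b
jumps-halves m {i} a b i<2 = trans (jumps-∷ʳ (suc m) (i + a * 2) b)
  (cong₂ (λ x y → jumps (suc m) x ((y + b) / 2) ∷ʳ b) ([i+a*2]/2≡a a i<2) ([i+a*2]%2≡i a i<2))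

shifted-difference : ∀ p {X Y} → Y ≤ X →
  ((+ X ℤ.- + p) ℤ.+ + 1) ℤ.- ((+ Y ℤ.- + p) ℤ.+ + 1) ≡ + (X ∸ Y)
shifted-difference p {X} {Y} Y≤X = begin
  ((+ X ℤ.- + p) ℤ.+ + 1) ℤ.- ((+ Y ℤ.- + p) ℤ.+ + 1)
    ≡⟨ cong (λ x → ((+ x ℤ.- + p) ℤ.+ + 1) ℤ.- ((+ Y ℤ.- + p) ℤ.+ + 1)) (sym (m+[n∸m]≡n Y≤X)) ⟩
  ((+ Y ℤ.+ + (X ∸ Y) ℤ.- + p) ℤ.+ + 1) ℤ.- ((+ Y ℤ.- + p) ℤ.+ + 1)
    ≡⟨ solve 3 (λ y z q → ((y :+ z) :- q :+ con (+ 1)) :- (y :- q :+ con (+ 1)) := z) refl (+ Y) (+ (X ∸ Y)) (+ p) ⟩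
  + (X ∸ Y)
    ∎
  where
  open ≡-Reasoning
  open ℤ-Solver.+-*-Solver

r-difference : ∀ d n k →
  zipWith ℤ._-_ (r d (n + k)) (r d n) ≡ V.map +_ (jumps d ((2 ^ d ∸ 1) * n) ((2 ^ d ∸ 1) * k))
r-difference d n k = begin
  zipWith ℤ._-_ (r d (n + k)) (r d n)            ≡⟨ zipWith-tabulate ℤ._-_ (λ j → rᵢ d j (n + k)) (λ j → rᵢ d j n) ⟩
  tabulate (λ j → rᵢ d j (n + k) ℤ.- rᵢ d j n)   ≡⟨ tabulate-cong rᵢ-difference ⟩
  tabulate (λ j → + jump (e j) (A * n) (A * k))  ≡⟨ tabulate-∘ +_ (λ j → jump (e j) (A * n) (A * k)) ⟩
  V.map +_ (jumps d (A * n) (A * k))          ∎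
  where
  open ≡-Reasoning
  A = 2 ^ d ∸ 1
  e : Fin d → ℕ
  e j = d ∸ suc (toℕ j)
  rᵢ-difference : ∀ j → rᵢ d j (n + k) ℤ.- rᵢ d j n ≡ + jump (e j) (A * n) (A * k)
  rᵢ-difference j = begin
    rᵢ d j (n + k) ℤ.- rᵢ d j n
      ≡⟨ cong (λ x → ((+ (x /2^ e j) ℤ.- + 2 ^ toℕ j) ℤ.+ + 1) ℤ.- rᵢ d j n) (*-distribˡ-+ A n k) ⟩
    ((+ ((A * n + A * k) /2^ e j) ℤ.- + 2 ^ toℕ j) ℤ.+ + 1) ℤ.- rᵢ d j n
      ≡⟨ shifted-difference (2 ^ toℕ j) (/-monoˡ-≤ (2 ^ e j) ⦃ m^n≢0 2 (e j) ⦄ (m≤m+n (A * n) (A * k))) ⟩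
    + jump (e j) (A * n) (A * k)
      ∎

InS⇔jumps : ∀ d x → InS d x ⇔
  ∃₂ λ n k → 1 ≤ n × x ≡ V.map +_ (jumps d ((2 ^ d ∸ 1) * n) ((2 ^ d ∸ 1) * k))
InS⇔jumps d x = mk⇔
  (λ { (m , n , 1≤n , n≤m , x≡) →
       n , m ∸ n , 1≤n , trans x≡ (trans (cong (λ y → zipWith ℤ._-_ (r d y) (r d n)) (sym (m+[n∸m]≡n n≤m)))
                                         (r-difference d n (m ∸ n))) })
  (λ { (n , k , 1≤n , x≡) → n + k , n , 1≤n , m≤m+n n k , trans x≡ (sym (r-difference d n k)) })

lastCoord-map-+ : ∀ {n} (v : Vec ℕ (suc n)) → lastCoord (V.map +_ v) ≡ + V.last v
lastCoord-map-+ (x ∷ [])     = refl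
lastCoord-map-+ (x ∷ y ∷ ys) = lastCoord-map-+ (y ∷ ys)

map-+-injective : ∀ {n} {u v : Vec ℕ n} → V.map +_ u ≡ V.map +_ v → u ≡ v
map-+-injective {u = []}    {[]}    _  = refl
map-+-injective {u = x ∷ u} {y ∷ v} eq = let x≡y , u≡v = ∷-injective eq in cong₂ _∷_ (ℤ.+-injective x≡y) (map-+-injective u≡v)

lastCoord-jumps : ∀ m a b → lastCoord (V.map +_ (jumps (suc m) a b)) ≡ + b
lastCoord-jumps m a b = trans (lastCoord-map-+ (jumps (suc m) a b)) (cong +_ (last-jumps m a b))

-- Enumerating jump vectors by their last entry

-- By jumps-∷ʳ the entry before the last one is a jump at ⌊(a % 2 + b)/2⌋ = ⌊b/2⌋ + i,
-- and exactly the i ≤ b % 2 occur.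
jumpVectors : (m : ℕ) → ℕ → List (Vec ℕ (suc m))
jumpVectors zero    b = L.[ b ∷ [] ]
jumpVectors (suc m) b = L.map (_∷ʳ b) (concatUpTo (λ i → jumpVectors m (b / 2 + i)) (suc (b % 2)))

jumpVectors-sound : ∀ m b {y} → y ∈ jumpVectors m b → ∃ λ a → y ≡ jumps (suc m) a b
jumpVectors-sound zero    b (here refl) = 0 , cong (_∷ []) (sym (jump-zero 0 b))
jumpVectors-sound (suc m) b y∈ with ∈-map⁻ (_∷ʳ b) y∈
... | z , z∈ , refl with ∈-concatUpTo⁻ (λ i → jumpVectors m (b / 2 + i)) (suc (b % 2)) z∈
... | i , i≤b%2 , z∈ᵢ with jumpVectors-sound m (b / 2 + i) z∈ᵢ
... | a , refl = i + a * 2 , sym (begin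
  jumps (suc (suc m)) (i + a * 2) b
    ≡⟨ jumps-halves m a b (<-≤-trans i≤b%2 (m%n<n b 2)) ⟩
  jumps (suc m) a ((i + b) / 2) ∷ʳ b
    ≡⟨ cong (λ x → jumps (suc m) a x ∷ʳ b) (half-carry b i) ⟩
  jumps (suc m) a (b / 2 + (b % 2 + i) / 2) ∷ʳ b
    ≡⟨ cong (λ x → jumps (suc m) a (b / 2 + x) ∷ʳ b) (carry-exact b i i≤b%2) ⟩
  jumps (suc m) a (b / 2 + i) ∷ʳ b
    ∎)
  where open ≡-Reasoning

jumpVectors-complete : ∀ m a b → jumps (suc m) a b ∈ jumpVectors m b
jumpVectors-complete zero    a b = here (cong (_∷ []) (jump-zero a b))
jumpVectors-complete (suc m) a b = subst (_∈ jumpVectors (suc m) b) (sym (jumps-∷ʳ (suc m) a b))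
  (∈-map⁺ (_∷ʳ b) (∈-concatUpTo⁺ (λ i → jumpVectors m (b / 2 + i)) (carry-bound b (a % 2) (m%n<n a 2))
    (subst (λ x → jumps (suc m) (a / 2) ((a % 2 + b) / 2) ∈ jumpVectors m x) (half-carry b (a % 2))
      (jumpVectors-complete m (a / 2) ((a % 2 + b) / 2)))))

last-jumpVectors : ∀ m b {y} → y ∈ jumpVectors m b → V.last y ≡ b
last-jumpVectors m b y∈ with jumpVectors-sound m b y∈
... | a , refl = last-jumps m a b

jumpVectors-unique : ∀ m b → Unique (jumpVectors m b)
jumpVectors-unique zero    b = [] ∷ []
jumpVectors-unique (suc m) b = map⁺ (∷ʳ-injectiveˡ _ _)
  (concatUpTo-unique (λ i → jumpVectors m (b / 2 + i)) (suc (b % 2))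
    (λ i → jumpVectors-unique m (b / 2 + i))
    (λ {i} {j} y∈i y∈j → +-cancelˡ-≡ (b / 2) i j
      (trans (sym (last-jumpVectors m (b / 2 + i) y∈i)) (last-jumpVectors m (b / 2 + j) y∈j))))

#jumpVectors : ℕ → ℕ → ℕ
#jumpVectors m b = length (jumpVectors m b)

#jumpVectors-suc : ∀ m b → #jumpVectors (suc m) b ≡ sumUpTo (λ i → #jumpVectors m (b / 2 + i)) (suc (b % 2))
#jumpVectors-suc m b = trans (length-map (_∷ʳ b) (concatUpTo _ (suc (b % 2))))
  (length-concatUpTo (λ i → jumpVectors m (b / 2 + i)) (suc (b % 2)))

#jumpVectors-halves : ∀ m {i} u → i < 2 → #jumpVectors (suc m) (i + u * 2) ≡ sumUpTo (λ j → #jumpVectors m (u + j)) (suc i)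
#jumpVectors-halves m {i} u i<2 = trans (#jumpVectors-suc m (i + u * 2))
  (cong₂ (λ x y → sumUpTo (λ j → #jumpVectors m (x + j)) (suc y)) ([i+a*2]/2≡a u i<2) ([i+a*2]%2≡i u i<2))

#jumpVectors-even : ∀ m u → #jumpVectors (suc m) (u * 2) ≡ #jumpVectors m u
#jumpVectors-even m u = trans (#jumpVectors-halves m u (s≤s z≤n)) (cong (#jumpVectors m) (+-identityʳ u))

#jumpVectors-odd : ∀ m u → #jumpVectors (suc m) (1 + u * 2) ≡ #jumpVectors m u + #jumpVectors m (suc u)
#jumpVectors-odd m u = trans (#jumpVectors-halves m u (s≤s (s≤s z≤n)))
  (cong₂ (λ x y → #jumpVectors m x + #jumpVectors m y) (+-identityʳ u) (+-comm u 1))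

#jumpVectors-periodic : ∀ m t b → #jumpVectors m (t * 2 ^ m + b) ≡ #jumpVectors m b
#jumpVectors-periodic zero    t b = refl
#jumpVectors-periodic (suc m) t b = begin
  #jumpVectors (suc m) (t * 2 ^ suc m + b)
    ≡⟨ cong (λ x → #jumpVectors (suc m) (x + b)) t*2^[1+m]≡t*2^m*2 ⟩
  #jumpVectors (suc m) (t * 2 ^ m * 2 + b)
    ≡⟨ #jumpVectors-suc m (t * 2 ^ m * 2 + b) ⟩
  sumUpTo (λ i → #jumpVectors m ((t * 2 ^ m * 2 + b) / 2 + i)) (suc ((t * 2 ^ m * 2 + b) % 2))
    ≡⟨ cong₂ (λ x y → sumUpTo (λ i → #jumpVectors m (x + i)) (suc y))
         (trans (+-distrib-/-∣ˡ b (divides-refl (t * 2 ^ m))) (cong (_+ b / 2) (m*n/n≡m (t * 2 ^ m) 2)))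
         (trans (cong (_% 2) (+-comm (t * 2 ^ m * 2) b)) ([m+kn]%n≡m%n b (t * 2 ^ m) 2)) ⟩
  sumUpTo (λ i → #jumpVectors m (t * 2 ^ m + b / 2 + i)) (suc (b % 2))
    ≡⟨ sumUpTo-cong (suc (b % 2)) (λ i _ →
         trans (cong (#jumpVectors m) (+-assoc (t * 2 ^ m) (b / 2) i)) (#jumpVectors-periodic m t (b / 2 + i))) ⟩
  sumUpTo (λ i → #jumpVectors m (b / 2 + i)) (suc (b % 2))
    ≡⟨ #jumpVectors-suc m b ⟨
  #jumpVectors (suc m) b
    ∎
  where
  open ≡-Reasoning
  t*2^[1+m]≡t*2^m*2 : t * 2 ^ suc m ≡ t * 2 ^ m * 2
  t*2^[1+m]≡t*2^m*2 = trans (cong (t *_) (*-comm 2 (2 ^ m))) (sym (*-assoc t (2 ^ m) 2))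

sum-#jumpVectors : ∀ m → sumUpTo (#jumpVectors m) (2 ^ m) ≡ 3 ^ m
sum-#jumpVectors zero    = refl
sum-#jumpVectors (suc m) = +-cancelʳ-≡ (#jumpVectors m 0) _ _ (begin
  sumUpTo (#jumpVectors (suc m)) (2 * 2 ^ m) + #jumpVectors m 0
    ≡⟨ cong (λ x → sumUpTo (#jumpVectors (suc m)) x + #jumpVectors m 0) (*-comm 2 (2 ^ m)) ⟩
  sumUpTo (#jumpVectors (suc m)) (2 ^ m * 2) + #jumpVectors m 0
    ≡⟨ sumUpTo-pairs (#jumpVectors-even m) (#jumpVectors-odd m) (2 ^ m) ⟩
  3 * sumUpTo (#jumpVectors m) (2 ^ m) + #jumpVectors m (2 ^ m)
    ≡⟨ cong₂ (λ x y → 3 * x + y) (sum-#jumpVectors m)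
         (trans (cong (#jumpVectors m) (sym (trans (+-identityʳ (1 * 2 ^ m)) (*-identityˡ (2 ^ m))))) (#jumpVectors-periodic m 1 0)) ⟩
  3 * 3 ^ m + #jumpVectors m 0
    ∎)
  where open ≡-Reasoning

module ShortcutMatrix (m : ℕ) where

  N A : ℕ
  N = 2 ^ m
  A = 2 ^ suc m ∸ 1

  A+1≡2*N : A + 1 ≡ 2 * N
  A+1≡2*N = m∸n+n≡m (m^n>0 2 (suc m))

  instance
    N-nonZero : ℕ.NonZero N
    N-nonZero = m^n≢0 2 m

    A-nonZero : ℕ.NonZero A
    A-nonZero = ℕ.>-nonZero (m<n⇒0<n∸m (*-monoʳ-≤ 2 (m^n>0 2 m)))

  -- A ≡ −1 modulo N.
  A*s≡t*N+[N∸s] : ∀ s → 1 ≤ s → s ≤ N → ∃ λ t → A * s ≡ t * N + (N ∸ s)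
  A*s≡t*N+[N∸s] (suc k) _ s≤N = 1 + 2 * k , +-cancelʳ-≡ (suc k) _ _ (begin
    A * suc k + suc k                     ≡⟨ solve 2 (λ a s → a :* s :+ s := (a :+ con 1) :* s) refl A (suc k) ⟩
    (A + 1) * suc k                       ≡⟨ cong (_* suc k) A+1≡2*N ⟩
    2 * N * suc k                         ≡⟨ solve 2 (λ n k → con 2 :* n :* (con 1 :+ k) := (con 1 :+ con 2 :* k) :* n :+ n) refl N k ⟩
    (1 + 2 * k) * N + N                   ≡⟨ cong (λ x → (1 + 2 * k) * N + x) (sym (m∸n+n≡m s≤N)) ⟩
    (1 + 2 * k) * N + (N ∸ suc k + suc k) ≡⟨ sym (+-assoc ((1 + 2 * k) * N) (N ∸ suc k) (suc k)) ⟩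
    (1 + 2 * k) * N + (N ∸ suc k) + suc k ∎)
    where
    open ≡-Reasoning
    open +-*-Solver

  jumps-multiple : ∀ a b → ∃ λ n → 1 ≤ n × jumps (suc m) (A * n) b ≡ jumps (suc m) a b
  jumps-multiple a b = N ∸ ρ , m<n⇒0<n∸m ρ<N , (begin
    jumps (suc m) (A * (N ∸ ρ)) b           ≡⟨ cong (λ x → jumps (suc m) x b) (proj₂ residue) ⟩
    jumps (suc m) (t * N + (N ∸ (N ∸ ρ))) b ≡⟨ jumps-periodic m t (N ∸ (N ∸ ρ)) b ⟩
    jumps (suc m) (N ∸ (N ∸ ρ)) b           ≡⟨ cong (λ x → jumps (suc m) x b) (m∸[m∸n]≡n (<⇒≤ ρ<N)) ⟩
    jumps (suc m) ρ b                       ≡⟨ jumps-periodic m (a / N) ρ b ⟨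
    jumps (suc m) (a / N * N + ρ) b         ≡⟨ cong (λ x → jumps (suc m) x b) a/N*N+ρ≡a ⟩
    jumps (suc m) a b                       ∎)
    where
    open ≡-Reasoning
    ρ = a % N
    ρ<N = m%n<n a N
    a/N*N+ρ≡a : a / N * N + ρ ≡ a
    a/N*N+ρ≡a = trans (+-comm (a / N * N) ρ) (sym (m≡m%n+[m/n]*n a N))
    residue = A*s≡t*N+[N∸s] (N ∸ ρ) (m<n⇒0<n∸m ρ<N) (m∸n≤m N ρ)
    t = proj₁ residue

  sum-#jumpVectors-multiples : sumUpTo (λ k → #jumpVectors m (A * k)) N ≡ 3 ^ m
  sum-#jumpVectors-multiples = begin
    sumUpTo (λ k → #jumpVectors m (A * k)) N        ≡⟨ sumUpTo-rotate (λ k → #jumpVectors m (A * k)) N #[A*N]≡#[A*0] ⟩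
    sumUpTo (λ k → #jumpVectors m (A * suc k)) N    ≡⟨ sumUpTo-cong N #[A*suc[k]]≡#[N∸suc[k]] ⟩
    sumUpTo (λ k → #jumpVectors m (N ∸ suc k)) N    ≡⟨ sumUpTo-reverse (#jumpVectors m) N ⟩
    sumUpTo (#jumpVectors m) N                      ≡⟨ sum-#jumpVectors m ⟩
    3 ^ m                                         ∎
    where
    open ≡-Reasoning
    #[A*N]≡#[A*0] : #jumpVectors m (A * N) ≡ #jumpVectors m (A * 0)
    #[A*N]≡#[A*0] = begin
      #jumpVectors m (A * N)      ≡⟨ cong (#jumpVectors m) (sym (+-identityʳ (A * N))) ⟩
      #jumpVectors m (A * N + 0)  ≡⟨ #jumpVectors-periodic m A 0 ⟩
      #jumpVectors m 0            ≡⟨ cong (#jumpVectors m) (*-zeroʳ A) ⟨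
      #jumpVectors m (A * 0)      ∎
    #[A*suc[k]]≡#[N∸suc[k]] : ∀ k → k < N → #jumpVectors m (A * suc k) ≡ #jumpVectors m (N ∸ suc k)
    #[A*suc[k]]≡#[N∸suc[k]] k k<N = let t , A*s≡ = A*s≡t*N+[N∸s] (suc k) (s≤s z≤n) k<N in
      trans (cong (#jumpVectors m) A*s≡) (#jumpVectors-periodic m t (N ∸ suc k))

  rows : List (Vec ℕ (suc m))
  rows = concatUpTo (λ k → jumpVectors m (A * k)) N

  ∈-rows⇔ : ∀ y → y ∈ rows ⇔ ∃₂ λ n k → 1 ≤ n × k < N × y ≡ jumps (suc m) (A * n) (A * k)
  ∈-rows⇔ y = mk⇔ to from
    where
    to : y ∈ rows → ∃₂ λ n k → 1 ≤ n × k < N × y ≡ jumps (suc m) (A * n) (A * k)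
    to y∈ with ∈-concatUpTo⁻ (λ k → jumpVectors m (A * k)) N y∈
    ... | k , k<N , y∈ₖ with jumpVectors-sound m (A * k) y∈ₖ
    ... | a , refl = let n , 1≤n , eq = jumps-multiple a (A * k) in n , k , 1≤n , k<N , sym eq
    from : (∃₂ λ n k → 1 ≤ n × k < N × y ≡ jumps (suc m) (A * n) (A * k)) → y ∈ rows
    from (n , k , _ , k<N , refl) = ∈-concatUpTo⁺ (λ k → jumpVectors m (A * k)) k<N (jumpVectors-complete m (A * n) (A * k))

  rows-unique : Unique rows
  rows-unique = concatUpTo-unique (λ k → jumpVectors m (A * k)) N (λ k → jumpVectors-unique m (A * k))
    (λ {i} {j} y∈i y∈j → *-cancelˡ-≡ i j A (trans (sym (last-jumpVectors m (A * i) y∈i)) (last-jumpVectors m (A * j) y∈j)))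

  length-rows : length rows ≡ 3 ^ m
  length-rows = trans (length-concatUpTo (λ k → jumpVectors m (A * k)) N) sum-#jumpVectors-multiples

  +A*k<+N*A⇔k<N : ∀ k → + (A * k) ℤ.< + (N * A) ⇔ k < N
  +A*k<+N*A⇔k<N k = mk⇔
    (λ A*k<N*A → *-cancelˡ-< A k N (subst (A * k <_) (*-comm N A) (ℤ.drop‿+<+ A*k<N*A)))
    (λ k<N → ℤ.+<+ (subst (A * k <_) (*-comm A N) (*-monoʳ-< A k<N)))

open ShortcutMatrix

theorem5 : (d : ℕ) → 2 ℕ.≤ d →
    Σ (List (Vec ℤ d)) λ L →
      Unique L × length L ≡ 3 ^ (d ∸ 1) ×
      ((x : Vec ℤ d) → (x ∈ L ⇔ (InS d x × lastCoord x ℤ.< + (2 ^ (d ∸ 1) ℕ.* (2 ^ d ∸ 1)))))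
theorem5 (suc m) _ =
  L.map (V.map (+_)) (rows m) , map⁺ map-+-injective (rows-unique m) ,
  trans (length-map (V.map (+_)) (rows m)) (length-rows m) , λ x → mk⇔ (to x) (from x)
  where
  to : ∀ x → x ∈ L.map (V.map (+_)) (rows m) → InS (suc m) x × lastCoord x ℤ.< + (N m * A m)
  to x x∈ with ∈-map⁻ (V.map (+_)) x∈
  ... | y , y∈ , refl with Equivalence.to (∈-rows⇔ m y) y∈
  ... | n , k , 1≤n , k<N , refl =
    Equivalence.from (InS⇔jumps (suc m) _) (n , k , 1≤n , refl) ,
    subst (ℤ._< _) (sym (lastCoord-jumps m (A m * n) (A m * k))) (Equivalence.from (+A*k<+N*A⇔k<N m k) k<N)
  from : ∀ x → InS (suc m) x × lastCoord x ℤ.< + (N m * A m) → x ∈ L.map (V.map (+_)) (rows m)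
  from x (x∈S , bound) with Equivalence.to (InS⇔jumps (suc m) x) x∈S
  ... | n , k , 1≤n , refl = ∈-map⁺ (V.map (+_)) (Equivalence.from (∈-rows⇔ m _)
    (n , k , 1≤n , Equivalence.to (+A*k<+N*A⇔k<N m k) (subst (ℤ._< _) (lastCoord-jumps m (A m * n) (A m * k)) bound) , refl))
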